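{- Let $\preceq$ be an entrenchment relation satisfying Left Disjunction. Then for all $\alpha,\beta\in\mathcal{L}$: $\neg\beta\preceq\neg\alpha$ if and only if $\alpha\mathrel{|\!\sim_\preceq}\beta$.
   Context: $\mathcal{L}$ is the set of formulas of a propositional language closed under $\lor,\land,\neg,\to$. $\vdash\subseteq 2^{\mathcal{L}}\times\mathcal{L}$ is a fixed consequence relation including classical propositional logic, compact, satisfying the deduction theorem and disjunction in premises; $\alpha\vdash\beta$ means $\{\alpha\}\vdash\beta$; $\mathrm{Cn}(X)=\{\beta:X\vdash\beta\}$, $\mathrm{Cn}(X,\alpha)=\mathrm{Cn}(X\cup\{\alpha\})$. An entrenchment relation is a binary relation $\preceq$ on $\mathcal{L}$ such that for all $\alpha,\beta,\gamma$: $\alpha\preceq\alpha$; $\alpha\vdash\beta$ and $\beta\preceq\gamma$ imply $\alpha\preceq\gamma$; if $\alpha\vdash\beta$ and $\beta\vdash\alpha$ then $\gamma\preceq\alpha$ iff $\gamma\preceq\beta$. Left Disjunction: for all $\alpha,\beta,\gamma$, $\beta\preceq\alpha$ and $\gamma\preceq\alpha$ imply $\beta\lor\gamma\preceq\alpha$. Maxiconsistent inference: $\mathrm{Coh}(\alpha)=\{\beta:\beta\not\preceq\neg\alpha\}$; $\mathcal{B}(\alpha)$ = deductively closed $U$ ($U=\mathrm{Cn}(U)$) with $U\subseteq\mathrm{Coh}(\alpha)$; $\mathcal{B}_{\max}(\alpha)$ = those $U\in\mathcal{B}(\alpha)$ with no deductively closed $U'\supsetneq U$ in $\mathcal{B}(\alpha)$;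 $E(\alpha)=\bigcap\{\mathrm{Cn}(U,\alpha):U\in\mathcal{B}_{\max}(\alpha)\}$ (empty intersection $=\mathcal{L}$); $\alpha\mathrel{|\!\sim_\preceq}\beta$ iff $\beta\in E(\alpha)$. -}

module Defs where

open import Level using (0ℓ)
open import Data.Bool using (Bool; true; false; _∧_; _∨_; not)
open import Data.Product using (Σ; ∃; _×_; _,_)
open import Data.List using (List)
open import Data.List.Relation.Unary.All using (All)
open import Relation.Nullary using (¬_)
open import Relation.Binary.PropositionalEquality using (_≡_)
open import Relation.Unary using (Pred; _∈_; _⊆_; _∪_; ｛_｝)

data Form (Atom : Set) : Set where
  atom : Atom → Form Atom
  _∨′_ : Form Atom → Form Atom → Form Atom
  _∧′_ : Form Atom → Form Atom → Form Atom
  ¬′_  : Form Atom → Form Atom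
  _⇒′_ : Form Atom → Form Atom → Form Atom

infixr 6 _∨′_
infixr 7 _∧′_
infix  8 ¬′_
infixr 5 _⇒′_

module _ {Atom : Set} where

  FSet : Set₁
  FSet = Pred (Form Atom) 0ℓ

  eval : (Atom → Bool) → Form Atom → Bool
  eval v (atom a) = v a
  eval v (φ ∨′ ψ) = eval v φ ∨ eval v ψ
  eval v (φ ∧′ ψ) = eval v φ ∧ eval v ψ
  eval v (¬′ φ)   = not (eval v φ)
  eval v (φ ⇒′ ψ) = not (eval v φ) ∨ eval v ψ

  _⊨_ : FSet → Form Atom → Set
  X ⊨ β = ∀ (v : Atom → Bool) → (∀ φ → φ ∈ X → eval v φ ≡ true) → eval v β ≡ true

  setOf : List (Form Atom) → FSet
  setOf xs φ = φ Data.List.Membership.Propositional.∈ xs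
    where import Data.List.Membership.Propositional

  record IsConsequence (_⊢_ : FSet → Form Atom → Set) : Set₁ where
    field
      supraclassical : ∀ {X β} → X ⊨ β → X ⊢ β
      reflexive      : ∀ {X β} → β ∈ X → X ⊢ β
      monotone       : ∀ {X Y β} → X ⊆ Y → X ⊢ β → Y ⊢ β
      cut            : ∀ {X Y β} → (∀ {γ} → γ ∈ Y → X ⊢ γ) → (X ∪ Y) ⊢ β → X ⊢ β
      compact        : ∀ {X β} → X ⊢ β →
                       Σ (List (Form Atom)) λ xs → All (_∈ X) xs × (setOf xs ⊢ β)
      deduction      : ∀ {X α β} → (X ∪ ｛ α ｝) ⊢ β → X ⊢ (α ⇒′ β)
      deduction⁻¹    : ∀ {X α β} → X ⊢ (α ⇒′ β) → (X ∪ ｛ α ｝) ⊢ β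
      disjPremises   : ∀ {X α β γ} → (X ∪ ｛ α ｝) ⊢ γ → (X ∪ ｛ β ｝) ⊢ γ →
                       (X ∪ ｛ α ∨′ β ｝) ⊢ γ

  module _ (_⊢_ : FSet → Form Atom → Set) where

    _⊢₁_ : Form Atom → Form Atom → Set
    α ⊢₁ β = ｛ α ｝ ⊢ β

    Cn : FSet → FSet
    Cn X β = X ⊢ β

    Cn₂ : FSet → Form Atom → FSet
    Cn₂ X α = Cn (X ∪ ｛ α ｝)

    Closed : FSet → Set
    Closed U = (U ⊆ Cn U) × (Cn U ⊆ U)

    record IsEntrenchment (_≼_ : Form Atom → Form Atom → Set) : Set where
      field
        refl≼      : ∀ {α} → α ≼ α
        dominance  : ∀ {α β γ} → α ⊢₁ β → β ≼ γ → α ≼ γ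
        equivRight : ∀ {α β γ} → α ⊢₁ β → β ⊢₁ α → (γ ≼ α → γ ≼ β) × (γ ≼ β → γ ≼ α)

    LeftDisjunction : (Form Atom → Form Atom → Set) → Set
    LeftDisjunction _≼_ = ∀ {α β γ} → β ≼ α → γ ≼ α → (β ∨′ γ) ≼ α

    module _ (_≼_ : Form Atom → Form Atom → Set) where

      Coh : Form Atom → FSet
      Coh α β = ¬ (β ≼ (¬′ α))

      𝓑 : Form Atom → FSet → Set
      𝓑 α U = Closed U × (U ⊆ Coh α)

      𝓑max : Form Atom → FSet → Set₁
      𝓑max α U = 𝓑 α U ×
        ¬ (Σ FSet λ U' → Closed U' × 𝓑 α U' × (U ⊆ U') × ¬ (U' ⊆ U))

      -- E(α) = ⋂ { Cn(U, α) : U ∈ 𝓑max(α) }   (empty intersection = L)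
      E : Form Atom → Pred (Form Atom) (Level.suc 0ℓ)
      E α β = ∀ (U : FSet) → 𝓑max α U → β ∈ Cn₂ U α

      _|~_ : Form Atom → Form Atom → Set₁
      α |~ β = β ∈ E α

{-# OPTIONS --safe #-}
module Submission where

-- Writing X = ¬≼¬ α = {φ : ¬φ ≼ ¬α}, the claim is E(α) = X.  Left Disjunction makes X
-- closed under modus ponens (¬γ ⊢ ¬φ ∨ ¬(φ → γ)), and compactness then makes it
-- deductively closed.
--   (⇒) If ¬β ≼ ¬α and U is maximal in 𝓑(α), then Cn(U, α → β) is still coherent: a member
--       δ with δ ≼ ¬α would give (α → β) → δ ≼ ¬β ∨ δ ≼ ¬α.  By maximality α → β ∈ U.
--   (⇐) For every valuation v satisfying X, the set Sat v of formulas true under v is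
--       maximal in 𝓑(α) (it is ⊢-closed although ⊢ may exceed classical logic, because
--       the ⊢-theorems lie in X) and contains α, so it contains β.  Thus X ⊨ β, whence
--       X ⊢ β and β ∈ X.
-- Maximality only yields α → β ∈ U up to double negation; ⊢ is ¬¬-stable by compactness.

open import Defs
open import Function.Base using (_∘_)
open import Function.Bundles using (_⇔_; mk⇔)
open import Data.Bool using (Bool; true; false)
open import Data.Empty using (⊥-elim)
open import Data.Sum using (_⊎_; inj₁; inj₂)
open import Data.Product using (Σ; _×_; _,_; proj₂)
open import Data.List using (_∷_; [])
open import Data.List.Relation.Unary.All using (All; _∷_; [])
open import Data.List.Relation.Unary.Any using (here; there)
open import Relation.Nullary using (¬_; Stable)
open import Relation.Binary.PropositionalEquality using (_≡_; refl)
open import Relation.Unary using (_∈_; _∉_; _⊆_; _∪_; ｛_｝; ∅)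

module Semantics {Atom : Set} where

  Sat : (Atom → Bool) → FSet {Atom}
  Sat v φ = eval v φ ≡ true

  _⊨₁_ : Form Atom → Form Atom → Set
  φ ⊨₁ ψ = ∀ v → φ ∈ Sat v → ψ ∈ Sat v

  module _ {v : Atom → Bool} where

    Sat-complete : ∀ φ → φ ∈ Sat v ⊎ (¬′ φ) ∈ Sat v
    Sat-complete φ with eval v φ
    ... | true  = inj₁ refl
    ... | false = inj₂ refl

    Sat-¬ : ∀ {φ} → φ ∈ Sat v → (¬′ φ) ∉ Sat v
    Sat-¬ {φ} with eval v φ
    ... | true  = λ _ ()
    ... | false = λ ()

    Sat-∧¬ : ∀ {φ} → (φ ∧′ ¬′ φ) ∉ Sat v
    Sat-∧¬ {φ} with eval v φ
    ... | true  = λ ()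
    ... | false = λ ()

    Sat-mp : ∀ {φ ψ} → φ ∈ Sat v → (φ ⇒′ ψ) ∈ Sat v → ψ ∈ Sat v
    Sat-mp {φ} with eval v φ
    ... | true  = λ _ ψ-true → ψ-true
    ... | false = λ ()

  ∧-⊨₁ˡ : ∀ φ ψ → (φ ∧′ ψ) ⊨₁ φ
  ∧-⊨₁ˡ φ _ v with eval v φ
  ... | true  = λ _ → refl
  ... | false = λ ()

  ¬¬-⊨₁ : ∀ φ → (¬′ ¬′ φ) ⊨₁ φ
  ¬¬-⊨₁ φ v with eval v φ
  ... | true  = λ _ → refl
  ... | false = λ ()

  ¬-⊨₁-¬∨¬⇒ : ∀ φ ψ → (¬′ ψ) ⊨₁ (¬′ φ ∨′ ¬′ (φ ⇒′ ψ))
  ¬-⊨₁-¬∨¬⇒ φ ψ v with eval v φ | eval v ψ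
  ... | false | _     = λ _ → refl
  ... | true  | false = λ _ → refl
  ... | true  | true  = λ ()

  ⇒⇒-⊨₁-¬∨ : ∀ φ ψ χ → ((φ ⇒′ ψ) ⇒′ χ) ⊨₁ (¬′ ψ ∨′ χ)
  ⇒⇒-⊨₁-¬∨ φ ψ χ v with eval v φ | eval v ψ
  ... | _     | false = λ _ → refl
  ... | true  | true  = λ χ-true → χ-true
  ... | false | true  = λ χ-true → χ-true

open Semantics

module Consequence {Atom : Set} (_⊢_ : FSet {Atom} → Form Atom → Set)
                   (isConsequence : IsConsequence _⊢_) where
  open IsConsequence isConsequence

  ⊢-⊨₁ : ∀ {X φ ψ} → X ⊢ φ → φ ⊨₁ ψ → X ⊢ ψ
  ⊢-⊨₁ {X} {φ} X⊢φ φ⊨ψ =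
    cut {Y = ｛ φ ｝} (λ { refl → X⊢φ }) (supraclassical (λ v v⊨ → φ⊨ψ v (v⊨ φ (inj₂ refl))))

  ⊨₁⇒⊢₁ : ∀ {φ ψ} → φ ⊨₁ ψ → _⊢₁_ _⊢_ φ ψ
  ⊨₁⇒⊢₁ = ⊢-⊨₁ (reflexive refl)

  ⊢-explosion : ∀ {X φ ψ} → X ⊢ φ → X ⊢ (¬′ φ) → X ⊢ ψ
  ⊢-explosion {X} {φ} X⊢φ X⊢¬φ = cut {Y = ｛ φ ｝ ∪ ｛ ¬′ φ ｝} premises contradiction
    where
      premises : ∀ {γ} → γ ∈ (｛ φ ｝ ∪ ｛ ¬′ φ ｝) → X ⊢ γ
      premises (inj₁ refl) = X⊢φ
      premises (inj₂ refl) = X⊢¬φ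
      contradiction : (X ∪ (｛ φ ｝ ∪ ｛ ¬′ φ ｝)) ⊢ _
      contradiction = supraclassical λ v v⊨ →
        ⊥-elim (Sat-¬ {φ = φ} (v⊨ φ (inj₂ (inj₁ refl))) (v⊨ (¬′ φ) (inj₂ (inj₂ refl))))

  -- Compactness turns the classically valid  {γ ∧ ¬γ | X ⊢ γ} ⊨ γ ∧ ¬γ  into a finite
  -- derivation: either it uses the premise γ ∧ ¬γ, which is a proof of X ⊢ γ, or it has
  -- no premises, and then ∅ ⊢ γ ∧ ¬γ.
  ⊢-stable : ∀ {X γ} → Stable (X ⊢ γ)
  ⊢-stable {X} {γ} ¬¬X⊢γ with compact {Y} {γ ∧′ ¬′ γ} (supraclassical Y⊨⊥)
    where
      Y : FSet
      Y φ = (γ ∧′ ¬′ γ ≡ φ) × X ⊢ γ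
      Y⊨⊥ : Y ⊨ (γ ∧′ ¬′ γ)
      Y⊨⊥ v v⊨ = ⊥-elim (¬¬X⊢γ λ X⊢γ → Sat-∧¬ {φ = γ} (v⊨ _ (refl , X⊢γ)))
  ... | _ ∷ _ , (_ , X⊢γ) ∷ _ , _ = X⊢γ
  ... | []    , []           , ⊢⊥ = ⊢-⊨₁ (monotone (λ ()) ⊢⊥) (∧-⊨₁ˡ γ (¬′ γ))

  Cn-closed : ∀ {X} → Closed _⊢_ (Cn _⊢_ X)
  Cn-closed = reflexive , λ X⊢Cn⊢γ → cut (λ X⊢δ → X⊢δ) (monotone inj₂ X⊢Cn⊢γ)

  Cn⊆-byModusPonens : ∀ {P : FSet} → (∀ {γ} → ∅ ⊢ γ → γ ∈ P) →
                      (∀ {φ γ} → φ ∈ P → (φ ⇒′ γ) ∈ P → γ ∈ P) → Cn _⊢_ P ⊆ P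
  Cn⊆-byModusPonens {P} theorems mp P⊢γ with compact P⊢γ
  ... | xs , xs⊆P , xs⊢γ = finite xs⊆P xs⊢γ
    where
      finite : ∀ {xs γ} → All (_∈ P) xs → setOf xs ⊢ γ → γ ∈ P
      finite []           xs⊢γ = theorems (monotone (λ ()) xs⊢γ)
      finite (x∈P ∷ xs⊆P) xs⊢γ = mp x∈P (finite xs⊆P (deduction (monotone split xs⊢γ)))
        where
          split : setOf (_ ∷ _) ⊆ (setOf _ ∪ ｛ _ ｝)
          split (here refl) = inj₂ refl
          split (there p)   = inj₁ p

  Sat-closed : ∀ {v} → (∀ {γ} → ∅ ⊢ γ → γ ∈ Sat v) → Closed _⊢_ (Sat v)
  Sat-closed theorems = reflexive , Cn⊆-byModusPonens theorems (λ {φ} {γ} → Sat-mp {φ = φ} {γ})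

  Sat-maximal : ∀ {v U ψ} → Sat v ⊆ U → ¬ (U ⊢ ψ) → U ⊆ Sat v
  Sat-maximal {v} Sat⊆U U⊬ψ {φ} φ∈U with Sat-complete {v = v} φ
  ... | inj₁ φ-true  = φ-true
  ... | inj₂ ¬φ-true = ⊥-elim (U⊬ψ (⊢-explosion (reflexive φ∈U) (reflexive (Sat⊆U ¬φ-true))))

module Entrenchment {Atom : Set} (_⊢_ : FSet {Atom} → Form Atom → Set)
                    (isConsequence : IsConsequence _⊢_)
                    (_≼_ : Form Atom → Form Atom → Set)
                    (isEntrenchment : IsEntrenchment _⊢_ _≼_)
                    (leftDisjunction : LeftDisjunction _⊢_ _≼_) where
  open IsConsequence isConsequence
  open IsEntrenchment isEntrenchment
  open Consequence _⊢_ isConsequence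

  ¬≼¬ : Form Atom → FSet
  ¬≼¬ α φ = (¬′ φ) ≼ (¬′ α)

  module _ {α : Form Atom} where

    α∈¬≼¬ : α ∈ ¬≼¬ α
    α∈¬≼¬ = refl≼

    theorem∈¬≼¬ : ∀ {γ} → ∅ ⊢ γ → γ ∈ ¬≼¬ α
    theorem∈¬≼¬ ⊢γ = dominance (⊢-explosion (monotone (λ ()) ⊢γ) (reflexive refl)) refl≼

    ¬≼¬-mp : ∀ {φ γ} → φ ∈ ¬≼¬ α → (φ ⇒′ γ) ∈ ¬≼¬ α → γ ∈ ¬≼¬ α
    ¬≼¬-mp {φ} {γ} ¬φ≼ ¬[φ⇒γ]≼ =
      dominance (⊨₁⇒⊢₁ (¬-⊨₁-¬∨¬⇒ φ γ)) (leftDisjunction ¬φ≼ ¬[φ⇒γ]≼)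

    ¬≼¬-closed : Cn _⊢_ (¬≼¬ α) ⊆ ¬≼¬ α
    ¬≼¬-closed = Cn⊆-byModusPonens theorem∈¬≼¬ ¬≼¬-mp

    Sat-coherent : ∀ {v} → ¬≼¬ α ⊆ Sat v → Sat v ⊆ Coh _⊢_ _≼_ α
    Sat-coherent ¬≼¬⊆Sat {δ} δ-true δ≼¬α =
      Sat-¬ {φ = δ} δ-true (¬≼¬⊆Sat {¬′ δ} (dominance (⊨₁⇒⊢₁ (¬¬-⊨₁ δ)) δ≼¬α))

    Sat∈𝓑max : ∀ {v} → ¬≼¬ α ⊆ Sat v → 𝓑max _⊢_ _≼_ α (Sat v)
    Sat∈𝓑max {v} ¬≼¬⊆Sat =
      (Sat-closed (¬≼¬⊆Sat ∘ theorem∈¬≼¬) , Sat-coherent ¬≼¬⊆Sat) , maximal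
      where
        maximal : ¬ (Σ FSet λ U → Closed _⊢_ U × 𝓑 _⊢_ _≼_ α U × (Sat v ⊆ U) × ¬ (U ⊆ Sat v))
        maximal (U , _ , ((_ , Cn⊆U) , U⊆Coh) , Sat⊆U , U⊈Sat) =
          U⊈Sat (Sat-maximal Sat⊆U λ U⊢¬α → U⊆Coh (Cn⊆U U⊢¬α) refl≼)

    𝓑max-absorbs : ∀ {U φ} → 𝓑max _⊢_ _≼_ α U → Cn₂ _⊢_ U φ ⊆ Coh _⊢_ _≼_ α → φ ∈ U
    𝓑max-absorbs {U} {φ} ((U-closed , _) , maximal) Cn₂⊆Coh =
      proj₂ U-closed (⊢-stable λ U⊬φ →
        maximal (Cn₂ _⊢_ U φ , Cn-closed , (Cn-closed , Cn₂⊆Coh) ,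
                 reflexive ∘ inj₁ , λ Cn₂⊆U → U⊬φ (reflexive (Cn₂⊆U (reflexive (inj₂ refl))))))

    ⇒-extension-coherent : ∀ {U β} → 𝓑 _⊢_ _≼_ α U → β ∈ ¬≼¬ α →
                           Cn₂ _⊢_ U (α ⇒′ β) ⊆ Coh _⊢_ _≼_ α
    ⇒-extension-coherent {β = β} ((_ , Cn⊆U) , U⊆Coh) ¬β≼ {δ} U,α⇒β⊢δ δ≼ =
      U⊆Coh (Cn⊆U (deduction U,α⇒β⊢δ))
            (dominance (⊨₁⇒⊢₁ (⇒⇒-⊨₁-¬∨ α β δ)) (leftDisjunction ¬β≼ δ≼))

    ¬≼¬⇒|~ : ∀ {β} → β ∈ ¬≼¬ α → _|~_ _⊢_ _≼_ α β
    ¬≼¬⇒|~ ¬β≼ U U∈𝓑max@(U∈𝓑 , _) =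
      deduction⁻¹ (reflexive (𝓑max-absorbs U∈𝓑max (⇒-extension-coherent U∈𝓑 ¬β≼)))

    |~⇒¬≼¬ : ∀ {β} → _|~_ _⊢_ _≼_ α β → β ∈ ¬≼¬ α
    |~⇒¬≼¬ {β} α|~β = ¬≼¬-closed (supraclassical ¬≼¬⊨β)
      where
        ¬≼¬⊨β : ¬≼¬ α ⊨ β
        ¬≼¬⊨β v v⊨ =
          proj₂ (Sat-closed theorems) (monotone absorb-α (α|~β (Sat v) (Sat∈𝓑max ¬≼¬⊆Sat)))
          where
            ¬≼¬⊆Sat : ¬≼¬ α ⊆ Sat v
            ¬≼¬⊆Sat = v⊨ _
            theorems : ∀ {γ} → ∅ ⊢ γ → γ ∈ Sat v
            theorems = ¬≼¬⊆Sat ∘ theorem∈¬≼¬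
            absorb-α : (Sat v ∪ ｛ α ｝) ⊆ Sat v
            absorb-α (inj₁ φ-true) = φ-true
            absorb-α (inj₂ refl)   = ¬≼¬⊆Sat α∈¬≼¬

mainTheorem8 : {Atom : Set}
    (_⊢_ : FSet {Atom} → Form Atom → Set) → IsConsequence _⊢_ →
    (_≼_ : Form Atom → Form Atom → Set) → IsEntrenchment _⊢_ _≼_ →
    LeftDisjunction _⊢_ _≼_ →
    ∀ (α β : Form Atom) → ((¬′ β) ≼ (¬′ α)) ⇔ _|~_ _⊢_ _≼_ α β
mainTheorem8 _⊢_ isConsequence _≼_ isEntrenchment leftDisjunction α β = mk⇔ ¬≼¬⇒|~ |~⇒¬≼¬
  where open Entrenchment _⊢_ isConsequence _≼_ isEntrenchment leftDisjunction
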